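{- Let $H$ be a connected bipartite graph of order $n_2$ and let $G$ be a non-trivial connected graph of order $n_1$, having $t_1$ true twin equivalence classes. If $\dim_l(G)=n_1-t_1$ and $D(G)<r(H)$, then $\dim_l(G\boxtimes H)= n_2(n_1-t_1)$.
   Context: $D(G)$ is the diameter of $G$ and $r(H)$ the radius of $H$. Two vertices $u,v$ are true twins if $N_G[u]=N_G[v]$; the true twin equivalence classes are the classes of the relation $N_G[x]=N_G[y]$. A set $S$ is a local metric generator for a connected graph $G$ if for every two adjacent vertices $x,y$ there is $s\in S$ with $d_G(s,x)\ne d_G(s,y)$; $\dim_l(G)$ is the minimum cardinality of a local metric generator. The strong product $G\boxtimes H$ has vertex set $V(G)\times V(H)$, with $(a,b)\sim(c,d)$ iff ($a=c$ and $b\sim d$) or ($b=d$ and $a\sim c$) or ($a\sim c$ and $b\sim d$). -}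

module Defs where

open import Data.Bool using (Bool; true; false; _∧_; _∨_; if_then_else_)
open import Data.Nat using (ℕ; zero; suc; _⊔_; _⊓_; _≤_)
open import Data.Fin using (Fin; _≟_; combine; remQuot)
open import Data.Fin.Subset using (Subset; _∈_; ∣_∣)
open import Data.List using (List; foldr; map)
open import Data.Bool.ListAction using (any)
open import Data.List using () renaming (map to lmap)
open import Data.Vec using (allFin; toList)
open import Data.Product using (Σ; ∃; _×_; _,_; proj₁; proj₂)
open import Relation.Nullary using (¬_; does)
open import Relation.Binary.PropositionalEquality using (_≡_; _≢_)

record Graph (n : ℕ) : Set where
  field
    adj : Fin n → Fin n → Bool
open Graph public

_~_within_ : ∀ {n} → Fin n → Fin n → Graph n → Set
u ~ v within G = adj G u v ≡ true

IsSimple : ∀ {n} → Graph n → Set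
IsSimple {n} G = (∀ u v → adj G u v ≡ adj G v u) × (∀ u → adj G u u ≡ false)

vertices : (n : ℕ) → List (Fin n)
vertices n = toList (allFin n)

reach : ∀ {n} → Graph n → ℕ → Fin n → Fin n → Bool
reach {n} G zero    u v = does (u ≟ v)
reach {n} G (suc k) u v =
  reach G k u v ∨ any (λ w → reach G k u w ∧ adj G w v) (vertices n)

Connected : ∀ {n} → Graph n → Set
Connected {n} G = ∀ u v → ∃ λ k → reach G k u v ≡ true

-- least i in [k, k + fuel) with p i = true; returns k + fuel if none
leastFrom : ℕ → ℕ → (ℕ → Bool) → ℕ
leastFrom k zero       p = k
leastFrom k (suc fuel) p = if p k then k else leastFrom (suc k) fuel p

-- shortest-path distance d_G(u,v) (a walk of length ≤ n always suffices
-- in a connected graph of order n, so the bounded search is exact there)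
dist : ∀ {n} → Graph n → Fin n → Fin n → ℕ
dist {n} G u v = leastFrom 0 (suc n) (λ k → reach G k u v)

maxL : List ℕ → ℕ
maxL = foldr _⊔_ 0

ecc : ∀ {n} → Graph n → Fin n → ℕ
ecc {n} G u = maxL (lmap (dist G u) (vertices n))

diam : ∀ {n} → Graph n → ℕ
diam {n} G = maxL (lmap (ecc G) (vertices n))

-- radius r(G) (minimum eccentricity; for n ≥ 1 the initial value n is
-- never attained since every eccentricity is < n in a connected graph)
radius : ∀ {n} → Graph n → ℕ
radius {n} G = foldr _⊓_ n (lmap (ecc G) (vertices n))

Bipartite : ∀ {n} → Graph n → Set
Bipartite {n} G = Σ (Fin n → Bool) λ c → ∀ u v → u ~ v within G → c u ≢ c v

closedN : ∀ {n} → Graph n → Fin n → Fin n → Bool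
closedN G x z = does (x ≟ z) ∨ adj G x z

TrueTwins : ∀ {n} → Graph n → Fin n → Fin n → Set
TrueTwins {n} G x y = ∀ z → closedN G x z ≡ closedN G y z

HasTwinClasses : ∀ {n} → Graph n → ℕ → Set
HasTwinClasses {n} G t =
  Σ (Fin n → Fin t) λ f →
    (∀ c → ∃ λ x → f x ≡ c) ×
    (∀ x y → (f x ≡ f y → TrueTwins G x y) × (TrueTwins G x y → f x ≡ f y))

IsLocalMetricGenerator : ∀ {n} → Graph n → Subset n → Set
IsLocalMetricGenerator {n} G S =
  ∀ x y → x ~ y within G → ∃ λ s → s ∈ S × dist G s x ≢ dist G s y

LocalMetricDim : ∀ {n} → Graph n → ℕ → Set
LocalMetricDim {n} G k =
  (∃ λ S → IsLocalMetricGenerator G S × ∣ S ∣ ≡ k) ×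
  (∀ S → IsLocalMetricGenerator G S → k ≤ ∣ S ∣)

-- strong product G ⊠ H on Fin (n₁ * n₂); vertex combine a b ↔ (a , b)
_⊠_ : ∀ {n₁ n₂} → Graph n₁ → Graph n₂ → Graph (n₁ Data.Nat.* n₂)
_⊠_ {n₁} {n₂} G H = record { adj = λ u v → go (remQuot n₂ u) (remQuot n₂ v) }
  where
  go : Fin n₁ × Fin n₂ → Fin n₁ × Fin n₂ → Bool
  go (a , b) (c , d) =
       (does (a ≟ c) ∧ adj H b d)
    ∨ (does (b ≟ d) ∧ adj G a c)
    ∨ (adj G a c ∧ adj H b d)

-- Vertices of G ⊠ H in the same twin class of G and the same H-coordinate are true twins, and a
-- local metric generator misses at most one vertex of each true twin class (two twins are adjacent
-- but equidistant from every other vertex); this gives the lower bound n₂ (n₁ − t₁).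
-- Conversely W × V(H) is a local metric generator for a minimum local metric generator W of G,
-- because d((w,x),(a,b)) = max (d_G(w,a), d_H(x,b)). Adjacent vertices with the same H-coordinate are
-- resolved inside the copy of W in that coordinate. If the H-coordinates b ~ d differ, pick x with
-- d_H(x,b) ≥ r(H) > D(G): the distance to (a,b) is d_H(x,b), while the distance to (c,d) is a smaller
-- G-distance or d_H(x,d), which has the other parity because H is bipartite.
module Submission where

open import Defs
open import Data.Nat using (ℕ; zero; suc; _≤_; _<_; _∸_; _*_; _+_; _⊔_; _⊓_; z≤n; s≤s; _≤′_; ≤′-refl; ≤′-step)
open import Data.Nat.Properties
  using (≤-trans; ≤-antisym; <⇒≤; <⇒≢; <⇒≱; ≤⇒≯; ≤-<-trans; <-≤-trans; ≤∧≢⇒<; ≤⇒≤′; n≤1+n; n<1+n; m≤n⇒m≤1+n;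
         n≤0⇒n≡0; m≤m+n; m≤n+m; +-identityʳ; +-suc; *-zeroʳ; *-suc; *-comm; *-distribʳ-∸; ∸-monoʳ-≤; m∸[m∸n]≡n;
         m≤m⊔n; m≤n⊔m; m≤n⇒m⊔n≡n; ⊔-sel; ⊔-lub; ⊔-identityʳ; m⊓n≤m; m⊓n≤n; module ≤-Reasoning)
open import Data.Bool using (Bool; true; false; _∧_; _∨_; not)
open import Data.Bool.Properties using (∧-conicalˡ; ∧-conicalʳ; ¬-not; T-≡)
open import Data.Fin using (Fin; zero; suc; _≟_; combine; remQuot; punchOut)
open import Data.Fin.Properties using (suc-injective; punchOut-injective; 0≢1+n; remQuot-combine; combine-remQuot; combine-injectiveˡ; combine-injectiveʳ)
open import Data.Bool.Solver using (module ∨-∧-Solver)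
open import Data.Fin.Subset using (Subset; _∈_; ∣_∣; ⊤; ⊥; ∁)
open import Data.Fin.Subset.Properties using (∣⊤∣≡n; ∣⊥∣≡0; ∣∁p∣≡n∸∣p∣; x∈∁p⇒x∉p; _∈?_; _⊂?_; ∣p∣≤n; p⊂q⇒∣p∣<∣q∣; x∈p⇒∣p-x∣<∣p∣)
open import Data.List using ([]; _∷_; foldr) renaming (map to lmap)
open import Data.List.Membership.Propositional using (lose) renaming (_∈_ to _∈ₗ_)
open import Data.List.Relation.Unary.Any using (here; there; satisfied)
open import Data.List.Relation.Unary.Any.Properties using (any⁺; any⁻)
open import Data.Bool.ListAction using (any)
open import Data.Vec using ([]; _∷_; here; there; tabulate; lookup; replicate; _++_)
open import Data.Vec.Properties using (lookup-++ˡ; lookup-++ʳ; lookup-replicate; lookup∘tabulate; []=⇒lookup; lookup⇒[]=)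
open import Data.Vec.Membership.Propositional.Properties using (∈-allFin⁺; ∈-toList⁺)
open import Data.Product using (∃; ∃₂; _×_; _,_; proj₁; proj₂)
open import Data.Sum using (_⊎_; inj₁; inj₂)
open import Function using (Equivalence; _⇔_; mk⇔)
open import Relation.Nullary using (does; yes; no; contradiction; _×-dec_)
open import Relation.Nullary.Decidable using (dec-true; does-⇔)
open import Relation.Binary.PropositionalEquality

open Equivalence using (to; from)

∨-true⁻ : ∀ {a b} → a ∨ b ≡ true → a ≡ true ⊎ b ≡ true
∨-true⁻ {true}  _ = inj₁ refl
∨-true⁻ {false} p = inj₂ p

∨-trueˡ : ∀ {a} b → a ≡ true → a ∨ b ≡ true
∨-trueˡ _ refl = refl

∨-trueʳ : ∀ a {b} → b ≡ true → a ∨ b ≡ true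
∨-trueʳ true  _ = refl
∨-trueʳ false p = p

∧-true⁺ : ∀ {a b} → a ≡ true → b ≡ true → a ∧ b ≡ true
∧-true⁺ refl refl = refl

≟-sound : ∀ {n} {a b : Fin n} → does (a ≟ b) ≡ true → a ≡ b
≟-sound {a = a} {b} p with a ≟ b
... | yes a≡b = a≡b

does-≟-sym : ∀ {n} (a b : Fin n) → does (a ≟ b) ≡ does (b ≟ a)
does-≟-sym a b = does-⇔ (mk⇔ sym sym) (a ≟ b) (b ≟ a)

∈-vertices : ∀ {n} (v : Fin n) → v ∈ₗ vertices n
∈-vertices v = ∈-toList⁺ (∈-allFin⁺ v)

any-true⁺ : ∀ {A : Set} (p : A → Bool) {xs x} → x ∈ₗ xs → p x ≡ true → any p xs ≡ true
any-true⁺ p x∈xs px = to T-≡ (any⁺ p (lose x∈xs (from T-≡ px)))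

any-true⁻ : ∀ {A : Set} (p : A → Bool) xs → any p xs ≡ true → ∃ λ x → p x ≡ true
any-true⁻ p xs e with satisfied (any⁻ p xs (from T-≡ e))
... | x , px = x , to T-≡ px

leastFrom-≤ : ∀ k f (p : ℕ → Bool) {m} → p m ≡ true → k ≤ m → leastFrom k f p ≤ m
leastFrom-≤ k zero    p pm k≤m = k≤m
leastFrom-≤ k (suc f) p {m} pm k≤m with p k in pk
... | true  = k≤m
... | false = leastFrom-≤ (suc k) f p pm (≤∧≢⇒< k≤m λ { refl → contradiction (trans (sym pk) pm) λ () })

leastFrom-hit : ∀ k f (p : ℕ → Bool) {m} → p m ≡ true → k ≤ m → m < k + f → p (leastFrom k f p) ≡ true
leastFrom-hit k zero    p {m} pm k≤m m<k+0 = contradiction (subst (m <_) (+-identityʳ k) m<k+0) (≤⇒≯ k≤m)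
leastFrom-hit k (suc f) p {m} pm k≤m m<k+f with p k in pk
... | true  = pk
... | false = leastFrom-hit (suc k) f p pm (≤∧≢⇒< k≤m λ { refl → contradiction (trans (sym pk) pm) λ () })
                (subst (m <_) (+-suc k f) m<k+f)

module _ {A : Set} (f : A → ℕ) where

  ≤-maxL : ∀ {xs x} → x ∈ₗ xs → f x ≤ maxL (lmap f xs)
  ≤-maxL {y ∷ _} (here refl) = m≤m⊔n (f y) _
  ≤-maxL {y ∷ _} (there x∈)  = ≤-trans (≤-maxL x∈) (m≤n⊔m (f y) _)

  <-maxL⁻ : ∀ {m} xs → m < maxL (lmap f xs) → ∃ λ x → m < f x
  <-maxL⁻ []       ()
  <-maxL⁻ (y ∷ ys) m<max with ⊔-sel (f y) (maxL (lmap f ys))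
  ... | inj₁ max≡fy = y , subst (_ <_) max≡fy m<max
  ... | inj₂ max≡ys = <-maxL⁻ ys (subst (_ <_) max≡ys m<max)

  foldr-⊓-≤ : ∀ b {xs x} → x ∈ₗ xs → foldr _⊓_ b (lmap f xs) ≤ f x
  foldr-⊓-≤ b {y ∷ _} (here refl) = m⊓n≤m (f y) _
  foldr-⊓-≤ b {y ∷ _} (there x∈)  = ≤-trans (m⊓n≤n (f y) _) (foldr-⊓-≤ b x∈)

⊔-≢ : ∀ {p q m} → p < m → q ≢ m → p ⊔ q ≢ m
⊔-≢ {p} {q} p<m q≢m with ⊔-sel p q
... | inj₁ p⊔q≡p = λ e → <⇒≢ p<m (trans (sym p⊔q≡p) e)
... | inj₂ p⊔q≡q = λ e → q≢m (trans (sym p⊔q≡q) e)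

injective⇒∣p∣≤ : ∀ {n m} (p : Subset n) (g : ∀ x → x ∈ p → Fin m) →
                 (∀ {x y} x∈p y∈p → g x x∈p ≡ g y y∈p → x ≡ y) → ∣ p ∣ ≤ m
injective⇒∣p∣≤ []            g inj = z≤n
injective⇒∣p∣≤ (false ∷ p)   g inj =
  injective⇒∣p∣≤ p (λ x x∈p → g (suc x) (there x∈p)) (λ x∈p y∈p e → suc-injective (inj (there x∈p) (there y∈p) e))
injective⇒∣p∣≤ {m = zero}  (true ∷ p) g inj with () ← g zero here
injective⇒∣p∣≤ {m = suc m} (true ∷ p) g inj = s≤s (injective⇒∣p∣≤ p g′ inj′)
  where
  g₀≢ : ∀ {x} (x∈p : x ∈ p) → g zero here ≢ g (suc x) (there x∈p)
  g₀≢ x∈p e = 0≢1+n (inj here (there x∈p) e)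
  g′ : ∀ x → x ∈ p → Fin m
  g′ x x∈p = punchOut (g₀≢ x∈p)
  inj′ : ∀ {x y} x∈p y∈p → g′ x x∈p ≡ g′ y y∈p → x ≡ y
  inj′ x∈p y∈p e = suc-injective (inj (there x∈p) (there y∈p) (punchOut-injective (g₀≢ x∈p) (g₀≢ y∈p) e))

∣p++q∣≡∣p∣+∣q∣ : ∀ {m n} (p : Subset m) (q : Subset n) → ∣ p ++ q ∣ ≡ ∣ p ∣ + ∣ q ∣
∣p++q∣≡∣p∣+∣q∣ []          q = refl
∣p++q∣≡∣p∣+∣q∣ (true ∷ p)  q = cong suc (∣p++q∣≡∣p∣+∣q∣ p q)
∣p++q∣≡∣p∣+∣q∣ (false ∷ p) q = ∣p++q∣≡∣p∣+∣q∣ p q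

blowUp : ∀ {m} n → Subset m → Subset (m * n)
blowUp n []      = []
blowUp n (x ∷ p) = replicate n x ++ blowUp n p

∣blowUp∣ : ∀ {m} n (p : Subset m) → ∣ blowUp n p ∣ ≡ n * ∣ p ∣
∣blowUp∣ n []          = sym (*-zeroʳ n)
∣blowUp∣ n (true ∷ p)  = begin
  ∣ replicate n true ++ blowUp n p ∣  ≡⟨ ∣p++q∣≡∣p∣+∣q∣ (replicate n true) (blowUp n p) ⟩
  ∣ ⊤ {n} ∣ + ∣ blowUp n p ∣          ≡⟨ cong₂ _+_ (∣⊤∣≡n n) (∣blowUp∣ n p) ⟩
  n + n * ∣ p ∣                       ≡⟨ *-suc n ∣ p ∣ ⟨
  n * suc ∣ p ∣                       ∎
  where open ≡-Reasoning
∣blowUp∣ n (false ∷ p) = begin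
  ∣ replicate n false ++ blowUp n p ∣  ≡⟨ ∣p++q∣≡∣p∣+∣q∣ (replicate n false) (blowUp n p) ⟩
  ∣ ⊥ {n} ∣ + ∣ blowUp n p ∣           ≡⟨ cong₂ _+_ (∣⊥∣≡0 n) (∣blowUp∣ n p) ⟩
  n * ∣ p ∣                            ∎
  where open ≡-Reasoning

lookup-blowUp : ∀ {m} n (p : Subset m) a b → lookup (blowUp n p) (combine a b) ≡ lookup p a
lookup-blowUp n (x ∷ p) zero    b = trans (lookup-++ˡ (replicate n x) (blowUp n p) b) (lookup-replicate b x)
lookup-blowUp n (x ∷ p) (suc a) b = trans (lookup-++ʳ (replicate n x) (blowUp n p) (combine a b)) (lookup-blowUp n p a b)

∈-blowUp : ∀ {m n} {p : Subset m} {a} b → a ∈ p → combine a b ∈ blowUp n p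
∈-blowUp {n = n} {p} {a} b a∈p = lookup⇒[]= (combine a b) (blowUp n p) (trans (lookup-blowUp n p a b) ([]=⇒lookup a∈p))

SymmetricGraph : ∀ {n} → Graph n → Set
SymmetricGraph {n} K = ∀ (u v : Fin n) → adj K u v ≡ adj K v u

module _ {n : ℕ} (K : Graph n) where

  closedN-refl : ∀ v → closedN K v v ≡ true
  closedN-refl v = ∨-trueˡ (adj K v v) (dec-true (v ≟ v) refl)

  closedN-sym : SymmetricGraph K → ∀ u v → closedN K u v ≡ closedN K v u
  closedN-sym sK u v = cong₂ _∨_ (does-≟-sym u v) (sK u v)

  -- Steps stay inside closed neighbourhoods, so a path may pause: Path k u v ⇔ reach K k u v ≡ true.
  data Path : ℕ → Fin n → Fin n → Set where
    []  : ∀ {u} → Path 0 u u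
    _▷_ : ∀ {k u w v} → Path k u w → closedN K w v ≡ true → Path (suc k) u v

  path⇒reach : ∀ {k u v} → Path k u v → reach K k u v ≡ true
  path⇒reach {u = u} [] = dec-true (u ≟ u) refl
  path⇒reach {suc k} {u} {v} (_▷_ {w = w} P c) with ∨-true⁻ {does (w ≟ v)} c
  ... | inj₁ w≡v = ∨-trueˡ _ (subst (λ x → reach K k u x ≡ true) (≟-sound w≡v) (path⇒reach P))
  ... | inj₂ w~v = ∨-trueʳ (reach K k u v) (any-true⁺ _ (∈-vertices w) (∧-true⁺ (path⇒reach P) w~v))

  reach⇒path : ∀ k {u v} → reach K k u v ≡ true → Path k u v
  reach⇒path zero    {u} r = subst (Path 0 u) (≟-sound r) []
  reach⇒path (suc k) {u} {v} r with ∨-true⁻ {reach K k u v} r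
  ... | inj₁ r′ = reach⇒path k r′ ▷ closedN-refl v
  ... | inj₂ e with any-true⁻ _ (vertices n) e
  ...   | w , rw = reach⇒path k (∧-conicalˡ _ _ rw) ▷ ∨-trueʳ (does (w ≟ v)) (∧-conicalʳ _ _ rw)

  path-mono : ∀ {k j u v} → k ≤ j → Path k u v → Path j u v
  path-mono k≤j = go (≤⇒≤′ k≤j)
    where
    go : ∀ {k j u v} → k ≤′ j → Path k u v → Path j u v
    go ≤′-refl        P = P
    go (≤′-step k≤′j) P = go k≤′j P ▷ closedN-refl _

  path-edge : ∀ {k u v} → Path k u v → u ≢ v → ∃₂ λ x y → x ~ y within K
  path-edge []                   u≢u = contradiction refl u≢u
  path-edge (_▷_ {w = w} P c) u≢v with ∨-true⁻ {does (w ≟ _)} c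
  ... | inj₁ w≡v = path-edge P λ u≡w → u≢v (trans u≡w (≟-sound w≡v))
  ... | inj₂ w~v = w , _ , w~v

  path-prepend : ∀ {k u w v} → closedN K u w ≡ true → Path k w v → Path (suc k) u v
  path-prepend c []      = [] ▷ c
  path-prepend c (P ▷ e) = path-prepend c P ▷ e

  path-reverse : SymmetricGraph K → ∀ {k u v} → Path k u v → Path k v u
  path-reverse sK []                      = []
  path-reverse sK (_▷_ {w = w} {v} P c) = path-prepend (trans (closedN-sym sK v w) c) (path-reverse sK P)

  data Walk : ℕ → Fin n → Fin n → Set where
    []  : ∀ {u} → Walk 0 u u
    _▷_ : ∀ {j u w v} → Walk j u w → w ~ v within K → Walk (suc j) u v

  walk⇒path : ∀ {j u v} → Walk j u v → Path j u v
  walk⇒path []        = []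
  walk⇒path (W ▷ w~v) = walk⇒path W ▷ ∨-trueʳ _ w~v

  path⇒walk : ∀ {k u v} → Path k u v → ∃ λ j → j ≤ k × Walk j u v
  path⇒walk [] = 0 , z≤n , []
  path⇒walk {u = u} (_▷_ {w = w} P c) with path⇒walk P | ∨-true⁻ {does (w ≟ _)} c
  ... | j , j≤k , W | inj₁ w≡v = j , m≤n⇒m≤1+n j≤k , subst (Walk j u) (≟-sound w≡v) W
  ... | j , j≤k , W | inj₂ w~v = suc j , s≤s j≤k , W ▷ w~v

  module _ (u : Fin n) where

    reachable : ℕ → Subset n
    reachable k = tabulate (reach K k u)

    ∈-reachable⁺ : ∀ {k v} → Path k u v → v ∈ reachable k
    ∈-reachable⁺ {k} {v} P = lookup⇒[]= v _ (trans (lookup∘tabulate (reach K k u) v) (path⇒reach P))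

    ∈-reachable⁻ : ∀ k {v} → v ∈ reachable k → Path k u v
    ∈-reachable⁻ k {v} v∈ = reach⇒path k (trans (sym (lookup∘tabulate (reach K k u) v)) ([]=⇒lookup v∈))

    Stalls : ℕ → Set
    Stalls j = ∀ {v} → Path (suc j) u v → Path j u v

    stalls-forever : ∀ {j} → Stalls j → ∀ i {v} → Path (i + j) u v → Path j u v
    stalls-forever st zero    P       = P
    stalls-forever st (suc i) (P ▷ c) = st (stalls-forever st i P ▷ c)

    reachable-grows : ∀ k → (∃ λ j → j ≤ k × Stalls j) ⊎ k < ∣ reachable k ∣
    reachable-grows zero = inj₂ (≤-<-trans z≤n (x∈p⇒∣p-x∣<∣p∣ (∈-reachable⁺ [])))
    reachable-grows (suc k) with reachable-grows k
    ... | inj₁ (j , j≤k , st) = inj₁ (j , m≤n⇒m≤1+n j≤k , st)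
    ... | inj₂ k<∣R∣ with reachable k ⊂? reachable (suc k)
    ...   | yes R⊂R′ = inj₂ (≤-<-trans k<∣R∣ (p⊂q⇒∣p∣<∣q∣ R⊂R′))
    ...   | no  R⊄R′ = inj₁ (k , n≤1+n k , stalled)
      where
      stalled : Stalls k
      stalled {v} P with v ∈? reachable k
      ... | yes v∈ = ∈-reachable⁻ k v∈
      ... | no  v∉ = contradiction
                       ((λ {x} x∈ → ∈-reachable⁺ (∈-reachable⁻ k x∈ ▷ closedN-refl x)) , v , ∈-reachable⁺ P , v∉)
                       R⊄R′

  -- The reachable sets grow strictly until they stall, and they live in a set of size n.
  path-within-order : ∀ {k u v} → Path k u v → Path n u v
  path-within-order {k} {u} P with reachable-grows u n
  ... | inj₁ (j , j≤n , st) = path-mono j≤n (stalls-forever u st k (path-mono (m≤m+n k j) P))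
  ... | inj₂ n<∣R∣          = contradiction (∣p∣≤n (reachable u n)) (<⇒≱ n<∣R∣)

  dist-minimal : ∀ {k u v} → Path k u v → dist K u v ≤ k
  dist-minimal {u = u} {v} P = leastFrom-≤ 0 (suc n) (λ k → reach K k u v) (path⇒reach P) z≤n

  path-dist : Connected K → ∀ u v → Path (dist K u v) u v
  path-dist cK u v = reach⇒path (dist K u v) (leastFrom-hit 0 (suc n) (λ k → reach K k u v)
    (path⇒reach (path-within-order (reach⇒path (proj₁ (cK u v)) (proj₂ (cK u v))))) z≤n (n<1+n n))

  dist-mono : Connected K → ∀ {u v u′ v′} → (∀ {k} → Path k u v → Path k u′ v′) → dist K u′ v′ ≤ dist K u v
  dist-mono cK {u} {v} f = dist-minimal (f (path-dist cK u v))

  dist-sym : SymmetricGraph K → Connected K → ∀ u v → dist K u v ≡ dist K v u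
  dist-sym sK cK u v = ≤-antisym (dist-mono cK (path-reverse sK)) (dist-mono cK (path-reverse sK))

  dist-refl : ∀ u → dist K u u ≡ 0
  dist-refl u = n≤0⇒n≡0 (dist-minimal [])

  walk-dist : Connected K → ∀ u v → Walk (dist K u v) u v
  walk-dist cK u v with path⇒walk (path-dist cK u v)
  ... | j , j≤d , W = subst (λ i → Walk i u v) (≤-antisym j≤d (dist-minimal (walk⇒path W))) W

  walk-colour : (c : Fin n → Bool) → (∀ u v → u ~ v within K → c u ≢ c v) →
                ∀ {j x v v′} → Walk j x v → Walk j x v′ → c v ≡ c v′
  walk-colour c proper []                  []                    = refl
  walk-colour c proper (_▷_ {w = w} W w~v) (_▷_ {w = w′} W′ w′~v′) = begin
    c _          ≡⟨ ¬-not (≢-sym (proper w _ w~v)) ⟩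
    not (c w)    ≡⟨ cong not (walk-colour c proper W W′) ⟩
    not (c w′)   ≡⟨ sym (¬-not (≢-sym (proper w′ _ w′~v′))) ⟩
    c _          ∎
    where open ≡-Reasoning

  bipartite-dist-≢ : Connected K → Bipartite K → ∀ x {u v} → u ~ v within K → dist K x u ≢ dist K x v
  bipartite-dist-≢ cK (c , proper) x {u} {v} u~v du≡dv = proper u v u~v
    (walk-colour c proper (walk-dist cK x u) (subst (λ i → Walk i x v) (sym du≡dv) (walk-dist cK x v)))

  twins-adjacent : ∀ {x y} → TrueTwins K x y → x ≢ y → x ~ y within K
  twins-adjacent {x} {y} tw x≢y with ∨-true⁻ {does (x ≟ y)} (trans (tw y) (closedN-refl y))
  ... | inj₁ x≡y = contradiction (≟-sound x≡y) x≢y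
  ... | inj₂ x~y = x~y

  path-twin : SymmetricGraph K → ∀ {x y s k} → TrueTwins K x y → s ≢ x → Path k s x → Path k s y
  path-twin sK tw s≢x []                       = contradiction refl s≢x
  path-twin sK {x} {y} tw s≢x (_▷_ {w = w} P c) = P ▷ (begin
    closedN K w y  ≡⟨ closedN-sym sK w y ⟩
    closedN K y w  ≡⟨ tw w ⟨
    closedN K x w  ≡⟨ closedN-sym sK x w ⟩
    closedN K w x  ≡⟨ c ⟩
    true           ∎)
    where open ≡-Reasoning

  twins-dist : SymmetricGraph K → Connected K → ∀ {x y s} → TrueTwins K x y → s ≢ x → s ≢ y →
               dist K s x ≡ dist K s y
  twins-dist sK cK tw s≢x s≢y = ≤-antisym
    (dist-mono cK (path-twin sK (λ z → sym (tw z)) s≢y))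
    (dist-mono cK (path-twin sK tw s≢x))

  dist-≤-diam : ∀ u v → dist K u v ≤ diam K
  dist-≤-diam u v = ≤-trans (≤-maxL (dist K u) (∈-vertices v)) (≤-maxL (ecc K) (∈-vertices u))

  far-vertex : SymmetricGraph K → Connected K → ∀ {m} → m < radius K → ∀ u → ∃ λ x → m < dist K x u
  far-vertex sK cK {m} m<r u with <-maxL⁻ (dist K u) (vertices n) (<-≤-trans m<r (foldr-⊓-≤ (ecc K) n (∈-vertices u)))
  ... | x , m<d = x , subst (m <_) (dist-sym sK cK u x) m<d

has-edge : ∀ {n} (K : Graph n) → 2 ≤ n → Connected K → ∃₂ λ x y → x ~ y within K
has-edge {zero}        K ()              _
has-edge {suc zero}    K (s≤s ())        _
has-edge {suc (suc _)} K _ cK with cK zero (suc zero)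
... | k , r = path-edge K (reach⇒path K k r) λ ()

local-metric-generator-≥ : ∀ {n t} (K : Graph n) → SymmetricGraph K → Connected K →
  (cls : Fin n → Fin t) → (∀ x y → cls x ≡ cls y → TrueTwins K x y) →
  ∀ S → IsLocalMetricGenerator K S → n ∸ t ≤ ∣ S ∣
local-metric-generator-≥ {n} {t} K sK cK cls twins S gen = begin
  n ∸ t             ≤⟨ ∸-monoʳ-≤ n (injective⇒∣p∣≤ (∁ S) (λ x _ → cls x) cls-injective) ⟩
  n ∸ ∣ ∁ S ∣        ≡⟨ cong (n ∸_) (∣∁p∣≡n∸∣p∣ S) ⟩
  n ∸ (n ∸ ∣ S ∣)    ≡⟨ m∸[m∸n]≡n (∣p∣≤n S) ⟩
  ∣ S ∣              ∎
  where
  open ≤-Reasoning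
  cls-injective : ∀ {x y} → x ∈ ∁ S → y ∈ ∁ S → cls x ≡ cls y → x ≡ y
  cls-injective {x} {y} x∈∁S y∈∁S e with x ≟ y
  ... | yes x≡y = x≡y
  ... | no  x≢y with gen x y (twins-adjacent K (twins x y e) x≢y)
  ...   | s , s∈S , ds≢ = contradiction
          (twins-dist K sK cK (twins x y e) (λ { refl → x∈∁p⇒x∉p x∈∁S s∈S }) (λ { refl → x∈∁p⇒x∉p y∈∁S s∈S }))
          ds≢

module StrongProduct {n₁ n₂ : ℕ} (G : Graph n₁) (H : Graph n₂) where

  π₁ : Fin (n₁ * n₂) → Fin n₁
  π₁ u = proj₁ (remQuot {n₁} n₂ u)

  π₂ : Fin (n₁ * n₂) → Fin n₂
  π₂ u = proj₂ (remQuot {n₁} n₂ u)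

  π₁-combine : ∀ a b → π₁ (combine {n₁} {n₂} a b) ≡ a
  π₁-combine a b = cong proj₁ (remQuot-combine a b)

  π₂-combine : ∀ a b → π₂ (combine {n₁} {n₂} a b) ≡ b
  π₂-combine a b = cong proj₂ (remQuot-combine a b)

  combine-π : ∀ u → combine (π₁ u) (π₂ u) ≡ u
  combine-π = combine-remQuot {n₁} n₂

  ≡⇔π≡ : ∀ {u v} → u ≡ v ⇔ (π₁ u ≡ π₁ v × π₂ u ≡ π₂ v)
  ≡⇔π≡ {u} {v} = mk⇔ (λ { refl → refl , refl })
    λ (e₁ , e₂) → trans (sym (combine-π u)) (trans (cong₂ combine e₁ e₂) (combine-π v))

  closedN-⊠ : ∀ u v → closedN (G ⊠ H) u v ≡ closedN G (π₁ u) (π₁ v) ∧ closedN H (π₂ u) (π₂ v)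
  closedN-⊠ u v rewrite does-⇔ ≡⇔π≡ (u ≟ v) (π₁ u ≟ π₁ v ×-dec π₂ u ≟ π₂ v) =
    distrib (does (π₁ u ≟ π₁ v)) (does (π₂ u ≟ π₂ v)) (adj G (π₁ u) (π₁ v)) (adj H (π₂ u) (π₂ v))
    where
    open ∨-∧-Solver
    distrib : ∀ a b g h → (a ∧ b) ∨ (a ∧ h) ∨ (b ∧ g) ∨ (g ∧ h) ≡ (a ∨ g) ∧ (b ∨ h)
    distrib = solve 4 (λ a b g h → (a :* b) :+ ((a :* h) :+ ((b :* g) :+ (g :* h))) := (a :+ g) :* (b :+ h)) refl

  closedN-⊠⁺ : ∀ {a b c d} → closedN G a c ≡ true → closedN H b d ≡ true →
               closedN (G ⊠ H) (combine a b) (combine c d) ≡ true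
  closedN-⊠⁺ {a} {b} {c} {d} ac bd
    rewrite closedN-⊠ (combine a b) (combine c d)
          | π₁-combine a b | π₂-combine a b | π₁-combine c d | π₂-combine c d = ∧-true⁺ ac bd

  path-⊠⁺ : ∀ {k a b c d} → Path G k a c → Path H k b d → Path (G ⊠ H) k (combine a b) (combine c d)
  path-⊠⁺ []        []        = []
  path-⊠⁺ (P ▷ ac) (Q ▷ bd) = path-⊠⁺ P Q ▷ closedN-⊠⁺ ac bd

  path-⊠ : ∀ {k u v} → Path G k (π₁ u) (π₁ v) → Path H k (π₂ u) (π₂ v) → Path (G ⊠ H) k u v
  path-⊠ {k} {u} {v} P Q = subst₂ (Path (G ⊠ H) k) (combine-π u) (combine-π v) (path-⊠⁺ P Q)

  path-⊠⁻ : ∀ {k u v} → Path (G ⊠ H) k u v → Path G k (π₁ u) (π₁ v) × Path H k (π₂ u) (π₂ v)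
  path-⊠⁻ [] = [] , []
  path-⊠⁻ (_▷_ {w = w} {v} P c) with path-⊠⁻ P
  ... | PG , PH = PG ▷ ∧-conicalˡ _ _ c′ , PH ▷ ∧-conicalʳ _ _ c′
    where c′ = trans (sym (closedN-⊠ w v)) c

  ⊠-connected : Connected G → Connected H → Connected (G ⊠ H)
  ⊠-connected cG cH u v with cG (π₁ u) (π₁ v) | cH (π₂ u) (π₂ v)
  ... | k , rG | j , rH = k + j , path⇒reach (G ⊠ H)
    (path-⊠ (path-mono G (m≤m+n k j) (reach⇒path G k rG)) (path-mono H (m≤n+m j k) (reach⇒path H j rH)))

  dist-⊠ : Connected G → Connected H → ∀ u v →
           dist (G ⊠ H) u v ≡ dist G (π₁ u) (π₁ v) ⊔ dist H (π₂ u) (π₂ v)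
  dist-⊠ cG cH u v = ≤-antisym
    (dist-minimal (G ⊠ H) (path-⊠ (path-mono G (m≤m⊔n dG dH) (path-dist G cG _ _))
                                  (path-mono H (m≤n⊔m dG dH) (path-dist H cH _ _))))
    (⊔-lub (dist-minimal G (proj₁ P)) (dist-minimal H (proj₂ P)))
    where
    dG = dist G (π₁ u) (π₁ v)
    dH = dist H (π₂ u) (π₂ v)
    P = path-⊠⁻ (path-dist (G ⊠ H) (⊠-connected cG cH) u v)

  ⊠-symmetric : SymmetricGraph G → SymmetricGraph H → SymmetricGraph (G ⊠ H)
  ⊠-symmetric sG sH u v = cong₂ _∨_ (cong₂ _∧_ (does-≟-sym (π₁ u) (π₁ v)) (sH (π₂ u) (π₂ v)))
    (cong₂ _∨_ (cong₂ _∧_ (does-≟-sym (π₂ u) (π₂ v)) (sG (π₁ u) (π₁ v))) (cong₂ _∧_ (sG (π₁ u) (π₁ v)) (sH (π₂ u) (π₂ v))))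

  twins-⊠ : ∀ {u v} → TrueTwins G (π₁ u) (π₁ v) → π₂ u ≡ π₂ v → TrueTwins (G ⊠ H) u v
  twins-⊠ {u} {v} tw e z = begin
    closedN (G ⊠ H) u z                                    ≡⟨ closedN-⊠ u z ⟩
    closedN G (π₁ u) (π₁ z) ∧ closedN H (π₂ u) (π₂ z)      ≡⟨ cong₂ (λ x y → x ∧ closedN H y (π₂ z)) (tw (π₁ z)) e ⟩
    closedN G (π₁ v) (π₁ z) ∧ closedN H (π₂ v) (π₂ z)      ≡⟨ closedN-⊠ v z ⟨
    closedN (G ⊠ H) v z                                    ∎
    where open ≡-Reasoning

  adj-⊠⁻ : ∀ {u v} → u ~ v within (G ⊠ H) →
             (π₁ u ≡ π₁ v × π₂ u ~ π₂ v within H)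
           ⊎ (π₂ u ≡ π₂ v × π₁ u ~ π₁ v within G)
           ⊎ (π₁ u ~ π₁ v within G × π₂ u ~ π₂ v within H)
  adj-⊠⁻ {u} {v} e with ∨-true⁻ {does (π₁ u ≟ π₁ v) ∧ adj H (π₂ u) (π₂ v)} e
  ... | inj₁ e₁ = inj₁ (≟-sound (∧-conicalˡ _ _ e₁) , ∧-conicalʳ _ _ e₁)
  ... | inj₂ e₂ with ∨-true⁻ {does (π₂ u ≟ π₂ v) ∧ adj G (π₁ u) (π₁ v)} e₂
  ...   | inj₁ e₃ = inj₂ (inj₁ (≟-sound (∧-conicalˡ _ _ e₃) , ∧-conicalʳ _ _ e₃))
  ...   | inj₂ e₄ = inj₂ (inj₂ (∧-conicalˡ _ _ e₄ , ∧-conicalʳ _ _ e₄))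

  ⊠-local-metric-generator-≥ : SymmetricGraph G → SymmetricGraph H → Connected G → Connected H →
    ∀ {t} (cls : Fin n₁ → Fin t) → (∀ a c → cls a ≡ cls c → TrueTwins G a c) →
    ∀ S → IsLocalMetricGenerator (G ⊠ H) S → n₂ * (n₁ ∸ t) ≤ ∣ S ∣
  ⊠-local-metric-generator-≥ sG sH cG cH {t} cls twins S gen = subst (_≤ ∣ S ∣) count
    (local-metric-generator-≥ (G ⊠ H) (⊠-symmetric sG sH) (⊠-connected cG cH)
      (λ u → combine (cls (π₁ u)) (π₂ u)) twins-⊠-cls S gen)
    where
    twins-⊠-cls : ∀ u v → combine (cls (π₁ u)) (π₂ u) ≡ combine (cls (π₁ v)) (π₂ v) → TrueTwins (G ⊠ H) u v
    twins-⊠-cls u v e = twins-⊠ {u} {v} (twins _ _ (combine-injectiveˡ (cls (π₁ u)) (π₂ u) (cls (π₁ v)) (π₂ v) e))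
                                  (combine-injectiveʳ (cls (π₁ u)) (π₂ u) (cls (π₁ v)) (π₂ v) e)
    count : n₁ * n₂ ∸ t * n₂ ≡ n₂ * (n₁ ∸ t)
    count = trans (sym (*-distribʳ-∸ n₂ n₁ t)) (*-comm (n₁ ∸ t) n₂)

  module _ (cG : Connected G) (cH : Connected H) where

    dist-⊠-combine : ∀ w x z → dist (G ⊠ H) (combine w x) z ≡ dist G w (π₁ z) ⊔ dist H x (π₂ z)
    dist-⊠-combine w x z = trans (dist-⊠ cG cH (combine w x) z)
      (cong₂ (λ a b → dist G a (π₁ z) ⊔ dist H b (π₂ z)) (π₁-combine w x) (π₂-combine w x))

    dist-⊠-column : ∀ w {z} → dist (G ⊠ H) (combine w (π₂ z)) z ≡ dist G w (π₁ z)
    dist-⊠-column w {z} = trans (dist-⊠-combine w (π₂ z) z)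
      (trans (cong (dist G w (π₁ z) ⊔_) (dist-refl H (π₂ z))) (⊔-identityʳ _))

    far-separates : Bipartite H → ∀ w x {u v} → π₂ u ~ π₂ v within H → diam G < dist H x (π₂ u) →
                    dist (G ⊠ H) (combine w x) u ≢ dist (G ⊠ H) (combine w x) v
    far-separates bH w x {u} {v} b~d D<d e = ⊔-≢
      (≤-<-trans (dist-≤-diam G w (π₁ v)) D<d)
      (≢-sym (bipartite-dist-≢ H cH bH x b~d))
      (sym (begin
        dist H x (π₂ u)                         ≡⟨ m≤n⇒m⊔n≡n (≤-trans (dist-≤-diam G w (π₁ u)) (<⇒≤ D<d)) ⟨
        dist G w (π₁ u) ⊔ dist H x (π₂ u)       ≡⟨ dist-⊠-combine w x u ⟨
        dist (G ⊠ H) (combine w x) u            ≡⟨ e ⟩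
        dist (G ⊠ H) (combine w x) v            ≡⟨ dist-⊠-combine w x v ⟩
        dist G w (π₁ v) ⊔ dist H x (π₂ v)       ∎))
      where open ≡-Reasoning

    far-witness : SymmetricGraph H → Bipartite H → diam G < radius H → ∀ {W : Subset n₁} {w₀} → w₀ ∈ W →
      ∀ {u v} → π₂ u ~ π₂ v within H → ∃ λ s → s ∈ blowUp n₂ W × dist (G ⊠ H) s u ≢ dist (G ⊠ H) s v
    far-witness sH bH D<r {w₀ = w₀} w₀∈W {u} b~d with far-vertex H sH cH D<r (π₂ u)
    ... | x , D<d = combine w₀ x , ∈-blowUp x w₀∈W , far-separates bH w₀ x b~d D<d

    ⊠-local-metric-generator : SymmetricGraph H → Bipartite H → diam G < radius H →
      ∀ {W : Subset n₁} {w₀} → IsLocalMetricGenerator G W → w₀ ∈ W → IsLocalMetricGenerator (G ⊠ H) (blowUp n₂ W)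
    ⊠-local-metric-generator sH bH D<r W-gen w₀∈W u v u~v with adj-⊠⁻ u~v
    ... | inj₁ (_ , b~d)        = far-witness sH bH D<r w₀∈W b~d
    ... | inj₂ (inj₂ (_ , b~d)) = far-witness sH bH D<r w₀∈W b~d
    ... | inj₂ (inj₁ (b≡d , a~c)) with W-gen _ _ a~c
    ...   | w , w∈W , dw≢ = combine w (π₂ u) , ∈-blowUp (π₂ u) w∈W , λ e → dw≢ (begin
      dist G w (π₁ u)                       ≡⟨ dist-⊠-column w ⟨
      dist (G ⊠ H) (combine w (π₂ u)) u     ≡⟨ e ⟩
      dist (G ⊠ H) (combine w (π₂ u)) v     ≡⟨ cong (λ y → dist (G ⊠ H) (combine w y) v) b≡d ⟩
      dist (G ⊠ H) (combine w (π₂ v)) v     ≡⟨ dist-⊠-column w ⟩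
      dist G w (π₁ v)                       ∎)
      where open ≡-Reasoning

theorem14 : (n₁ n₂ t₁ : ℕ) (G : Graph n₁) (H : Graph n₂) →
    IsSimple G → IsSimple H → 1 ≤ n₂ →
    Connected H → Bipartite H →
    2 ≤ n₁ → Connected G → HasTwinClasses G t₁ →
    LocalMetricDim G (n₁ ∸ t₁) → diam G < radius H →
    LocalMetricDim (G ⊠ H) (n₂ * (n₁ ∸ t₁))
theorem14 n₁ n₂ t₁ G H sG sH _ cH bH 2≤n₁ cG (cls , _ , twin-classes) ((W , W-gen , ∣W∣≡) , _) D<r
  with has-edge G 2≤n₁ cG
... | x , y , x~y with W-gen x y x~y
...   | w₀ , w₀∈W , _ =
  ( blowUp n₂ W
  , StrongProduct.⊠-local-metric-generator G H cG cH (proj₁ sH) bH D<r W-gen w₀∈W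
  , trans (∣blowUp∣ n₂ W) (cong (n₂ *_) ∣W∣≡) )
  , StrongProduct.⊠-local-metric-generator-≥ G H (proj₁ sG) (proj₁ sH) cG cH cls (λ a c → proj₁ (twin-classes a c))
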